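{- For all $d,h,k\ge 2$: $$\#\mathrm{detBstates}^h_d(k)\le\#\mathrm{detFstates}^h_d(k)\le k\cdot\#\mathrm{detBstates}^h_d(k),$$ $$\#\mathrm{ndetBstates}^h_d(k)\le\#\mathrm{ndetFstates}^h_d(k)\le k\cdot\#\mathrm{ndetBstates}^h_d(k).$$
   Context: $T^h_d$ is the balanced rooted $d$-ary tree with $h$ levels. An instance with parameter $k$ assigns to each internal node $i$ a function $f_i:[k]^d\to[k]$ (given by its $k^d$ values) and to each leaf an element of $[k]=\{1,\dots,k\}$; $v_i$ is the leaf label for a leaf and $v_i=f_i(v_{j_1},\dots,v_{j_d})$ for an internal node with children $j_1,\dots,j_d$. $FT^h_d(k)$: output the root value; $BT^h_d(k)$: decide whether it is $1$. A nondeterministic $k$-way branching program computing $g:[k]^m\to R$ is a directed rooted multigraph of states, edges labelled by elements of $[k]$, nonfinal states labelled by variable indices, $|R|$ final sink states labelled by elements of $R$; on input $x$, edges labelled $x_j$ out of states labelled $j$ are activated; each computation (path of activated edges from the root) is infinite, ends in the final state labelled $g(x)$, or aborts, and at least one ends in a final state. Deterministic: every nonfinal state has exactly $k$ outedges labelled $1,\dots,k$. $\#\mathrm{detFstates}^h_d(k)$, $\#\mathrm{ndetFstates}^h_d(k)$ are the minimum numbers of states of deterministic/nondeterministic $k$-way programs computing $FT^h_d(k)$; $\#\mathrm{detBstates}^h_d(k)$, $\#\mathrm{ndetBstates}^h_d(k)$ likewise for $BT^h_d(k)$. -}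

module Defs where

open import Data.Nat using (ℕ; zero; suc; _∸_; _≤_)
open import Data.Fin using (Fin; zero; suc) renaming (_≟_ to _≟ᶠ_)
open import Data.Vec using (Vec; tabulate)
open import Data.Bool using (Bool; true; false)
open import Data.Unit using (⊤; tt)
open import Data.Sum using (_⊎_; inj₁; inj₂)
open import Data.Product using (Σ; _×_; _,_; proj₁; proj₂)
open import Data.List using (List; length; filter)
open import Data.List.Membership.Propositional using (_∈_)
open import Relation.Nullary using (¬_)
open import Relation.Nullary.Decidable using (_×-dec_)
open import Relation.Binary.PropositionalEquality using (_≡_)

-- TV d k e : the input variables of an instance on the balanced d-ary
-- tree with (suc e) levels:
--   * e = 0 : the tree is a single leaf, one variable (its label);
--   * e = suc e' : the root function f_root : [k]^d → [k] is given by its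
--     k^d values, one variable per argument tuple (Vec (Fin k) d), plus
--     the variables of the d child subtrees (indexed by Fin d).
-- Elements of [k] = {1,…,k} are represented by Fin k (1 ↦ zero).

TV : ℕ → ℕ → ℕ → Set
TV d k zero    = ⊤
TV d k (suc e) = Vec (Fin k) d ⊎ (Fin d × TV d k e)

evalT : (d k e : ℕ) → (TV d k e → Fin k) → Fin k
evalT d k zero    x = x tt
evalT d k (suc e) x =
  x (inj₁ (tabulate (λ i → evalT d k e (λ v → x (inj₂ (i , v))))))

-- variables of an instance of T^h_d (h levels)
TreeVar : ℕ → ℕ → ℕ → Set
TreeVar d h k = TV d k (h ∸ 1)

FT : (d h k : ℕ) → (TreeVar d h k → Fin k) → Fin k
FT d h k = evalT d k (h ∸ 1)

isOne : ∀ {k} → Fin k → Bool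
isOne zero    = true
isOne (suc _) = false

BT : (d h k : ℕ) → (TreeVar d h k → Fin k) → Bool
BT d h k x = isOne (FT d h k x)

data Label (V R : Set) : Set where
  final : R → Label V R
  query : V → Label V R

Edge : ℕ → ℕ → Set
Edge n k = Fin n × Fin k × Fin n

record BP (V R : Set) (k n : ℕ) : Set where
  field
    root   : Fin n
    label  : Fin n → Label V R
    edges  : List (Edge n k)            -- multigraph: multiplicities allowed
    sink   : ∀ {s a t} → (s , a , t) ∈ edges → ∀ r → ¬ (label s ≡ final r)
    finalE : ∀ r → Σ (Fin n) (λ s → label s ≡ final r)
    finalU : ∀ r s s' → label s ≡ final r → label s' ≡ final r → s ≡ s'
open BP public

outEdges : ∀ {V R k n} → BP V R k n → Fin n → Fin k → List (Edge n k)
outEdges P s a =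
  filter (λ e → (proj₁ e ≟ᶠ s) ×-dec (proj₁ (proj₂ e) ≟ᶠ a)) (edges P)

Deterministic : ∀ {V R k n} → BP V R k n → Set
Deterministic {V} {R} {k} {n} P =
  ∀ (s : Fin n) (j : V) → label P s ≡ query j →
  ∀ (a : Fin k) → length (outEdges P s a) ≡ 1

data Reach {V R : Set} {k n : ℕ} (P : BP V R k n) (x : V → Fin k)
     : Fin n → Fin n → Set where
  here : ∀ {s} → Reach P x s s
  step : ∀ {s a t u} (j : V) → (s , a , t) ∈ edges P →
         label P s ≡ query j → x j ≡ a → Reach P x t u → Reach P x s u

-- P computes g: every computation ending in a final state ends in the one
-- labelled g(x), and at least one computation ends in a final state
-- (other computations may be infinite or abort).
Computes : ∀ {V R k n} → BP V R k n → ((V → Fin k) → R) → Set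
Computes {V} {R} {k} {n} P g =
  ∀ (x : V → Fin k) →
    (∀ (t : Fin n) (r : R) → Reach P x (root P) t → label P t ≡ final r → r ≡ g x)
  × Σ (Fin n) (λ t → Σ R (λ r → Reach P x (root P) t × label P t ≡ final r))

DetProg NdetProg : (V R : Set) (k : ℕ) → ((V → Fin k) → R) → ℕ → Set
DetProg  V R k g n = Σ (BP V R k n) (λ P → Deterministic P × Computes P g)
NdetProg V R k g n = Σ (BP V R k n) (λ P → Computes P g)

IsMin : (ℕ → Set) → ℕ → Set
IsMin Q m = Q m × (∀ n → Q n → m ≤ n)

IsDetF IsDetB IsNdetF IsNdetB : (d h k : ℕ) → ℕ → Set
IsDetF  d h k = IsMin (DetProg  (TreeVar d h k) (Fin k) k (FT d h k))
IsDetB  d h k = IsMin (DetProg  (TreeVar d h k) Bool    k (BT d h k))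
IsNdetF d h k = IsMin (NdetProg (TreeVar d h k) (Fin k) k (FT d h k))
IsNdetB d h k = IsMin (NdetProg (TreeVar d h k) Bool    k (BT d h k))

module Submission where

-- Both inequality chains follow from two program transformations,
-- valid for arbitrary variable sets and preserving determinism:
--
--  * Decide: a k-way program computing g : [k]^V → [k] (k ≥ 2) becomes a
--    program with the same states deciding "g(x) = 1": the final state 1
--    accepts, 2 rejects, and every other final state r is turned into a
--    query state with all k edges leading to the rejecting state.
--
--  * Search: given a program deciding h, and for each i ∈ [k] a relabelling
--    σ_i of the input values with h(σ_i x) = 1 ⇔ g(x) = i, run k copies of
--    the program; copy i decides h(σ_i x) (edge labels are pulled back
--    along σ_i), outputs i when it accepts and moves on to copy i+1 when it
--    rejects.  This computes g with k·n states.
--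
-- For the tree problem, σ_i swaps the values 1 and i of the root function,
-- so FT(σ_i x) = (1 i)(FT x).  The theorem then follows from a general
-- fact about minima of two predicates related by these transformations.

open import Defs
open import Data.Nat as ℕ using (ℕ; zero; suc; _+_; _*_; _≤_; s≤s; z≤n; _<?_)
open import Data.Nat.Properties using (+-identityʳ; +-suc; ≤-trans; m<m+n)
open import Data.Fin as Fin using (Fin; zero; suc; toℕ; fromℕ<; combine; remQuot)
  renaming (_≟_ to _≟ᶠ_)
open import Data.Fin.Properties
  using (toℕ-injective; toℕ<n; toℕ-fromℕ<; remQuot-combine; combine-injective; combine-surjective; ≤∧≢⇒<; <⇒≢; 0≢1+n; suc-injective)
open import Data.Fin.Permutation using (Permutation′; _⟨$⟩ʳ_; _⟨$⟩ˡ_; inverseˡ; inverseʳ; transpose; id)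
import Data.Fin.Permutation.Components as Components
open import Data.Bool using (Bool; true; false)
open import Data.Bool.Properties using (¬-not)
open import Data.Vec using (replicate)
open import Data.List using (List; []; _∷_; _++_; length; filter; concat; tabulate; map)
open import Data.List.Properties using (filter-++; length-++; filter-none; filter-accept; filter-reject)
open import Data.List.Membership.Propositional using (_∈_)
open import Data.List.Membership.Propositional.Properties
  using (∈-++⁺ˡ; ∈-++⁺ʳ; ∈-++⁻; ∈-map⁺; ∈-map⁻; ∈-tabulate⁺; ∈-tabulate⁻; ∈-concat⁺′; ∈-concat⁻′)
import Data.List.Relation.Unary.All as All
import Data.List.Relation.Unary.Any as Any
open import Data.Product using (Σ; _×_; _,_; proj₁; proj₂)
open import Data.Sum using (_⊎_; inj₁; inj₂)
open import Data.Empty using (⊥-elim)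
open import Function.Bundles using (_⇔_; mk⇔; Equivalence)
open import Function.Construct.Identity using (⇔-id)
open import Function.Construct.Composition using (_⇔-∘_)
open import Relation.Nullary using (¬_; yes; no)
open import Relation.Nullary.Decidable using (_×-dec_)
open import Relation.Unary using (Pred; Decidable)
open import Level using (0ℓ)
open import Relation.Binary.PropositionalEquality

∈-blocks⁺ : ∀ {A : Set} {m} (f : Fin m → List A) (i : Fin m) {e} → e ∈ f i → e ∈ concat (tabulate f)
∈-blocks⁺ f i e∈ = ∈-concat⁺′ e∈ (∈-tabulate⁺ i)

∈-blocks⁻ : ∀ {A : Set} {m} (f : Fin m → List A) {e} → e ∈ concat (tabulate f) → Σ (Fin m) (λ i → e ∈ f i)
∈-blocks⁻ f e∈ with ∈-concat⁻′ (tabulate f) e∈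
... | xs , e∈xs , xs∈ with ∈-tabulate⁻ xs∈
... | i , refl = i , e∈xs

module Counting {A : Set} {P : Pred A 0ℓ} (P? : Decidable P) where

  count : List A → ℕ
  count xs = length (filter P? xs)

  count-++ : ∀ xs ys → count (xs ++ ys) ≡ count xs + count ys
  count-++ xs ys rewrite filter-++ P? xs ys = length-++ (filter P? xs)

  count-none : ∀ xs → (∀ {e} → e ∈ xs → ¬ P e) → count xs ≡ 0
  count-none xs none = cong length (filter-none P? (All.tabulate none))

  count-tabulate-unique : ∀ {m} (f : Fin m → A) (i : Fin m) →
    P (f i) → (∀ j → P (f j) → j ≡ i) → count (tabulate f) ≡ 1
  count-tabulate-unique f zero pᵢ unique
    rewrite filter-accept P? {xs = tabulate (λ j → f (suc j))} pᵢ =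
    cong suc (count-none _ rest)
    where
    rest : ∀ {e} → e ∈ tabulate (λ j → f (suc j)) → ¬ P e
    rest e∈ p with ∈-tabulate⁻ e∈
    ... | j , refl with unique (suc j) p
    ... | ()
  count-tabulate-unique f (suc i) pᵢ unique
    rewrite filter-reject P? {xs = tabulate (λ j → f (suc j))} (λ p → 0≢1+n (unique zero p)) =
    count-tabulate-unique (λ j → f (suc j)) i pᵢ (λ j p → suc-injective (unique (suc j) p))

  count-block : ∀ {m} (f : Fin m → List A) (i : Fin m) →
    (∀ j {e} → e ∈ f j → P e → j ≡ i) → count (concat (tabulate f)) ≡ count (f i)
  count-block f zero only = begin
    count (f zero ++ concat (tabulate (λ j → f (suc j))))
      ≡⟨ count-++ (f zero) _ ⟩
    count (f zero) + count (concat (tabulate (λ j → f (suc j))))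
      ≡⟨ cong (count (f zero) +_) (count-none _ outside) ⟩
    count (f zero) + 0
      ≡⟨ +-identityʳ _ ⟩
    count (f zero) ∎
    where
    open ≡-Reasoning
    outside : ∀ {e} → e ∈ concat (tabulate (λ j → f (suc j))) → ¬ P e
    outside e∈ p with ∈-blocks⁻ (λ j → f (suc j)) e∈
    ... | j , e∈j with only (suc j) e∈j p
    ... | ()
  count-block f (suc i) only =
    trans (count-++ (f zero) _)
          (cong₂ _+_ (count-none (f zero) λ e∈ p → 0≢1+n (only zero e∈ p))
                     (count-block (λ j → f (suc j)) i λ j e∈ p → suc-injective (only (suc j) e∈ p)))

open Counting using (count; count-++; count-none; count-tabulate-unique; count-block)

count-map : ∀ {A B : Set} {P : Pred A 0ℓ} {Q : Pred B 0ℓ} (P? : Decidable P) (Q? : Decidable Q)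
  (f : B → A) (xs : List B) → (∀ {e} → e ∈ xs → P (f e) ⇔ Q e) →
  count P? (map f xs) ≡ count Q? xs
count-map P? Q? f [] agree = refl
count-map P? Q? f (x ∷ xs) agree with P? (f x) | Q? x | agree (Any.here refl)
... | yes _ | yes _ | _ = cong suc (count-map P? Q? f xs (λ e∈ → agree (Any.there e∈)))
... | no _  | no _  | _ = count-map P? Q? f xs (λ e∈ → agree (Any.there e∈))
... | yes p | no ¬q | p⇔q = ⊥-elim (¬q (Equivalence.to p⇔q p))
... | no ¬p | yes q | p⇔q = ⊥-elim (¬p (Equivalence.from p⇔q q))

-- e is an outedge of s labelled a; outEdges P s a filters by exactly this
IsOut : ∀ {n k} → Fin n → Fin k → Edge n k → Set
IsOut s a e = proj₁ e ≡ s × proj₁ (proj₂ e) ≡ a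

isOut? : ∀ {n k} (s : Fin n) (a : Fin k) → Decidable (IsOut s a)
isOut? s a e = (proj₁ e ≟ᶠ s) ×-dec (proj₁ (proj₂ e) ≟ᶠ a)

fan : ∀ {n k} → Fin n → Fin n → List (Edge n k)
fan s t = tabulate (λ a → s , a , t)

out-fan : ∀ {n k} (s t : Fin n) (a : Fin k) → count (isOut? s a) (fan s t) ≡ 1
out-fan s t a = count-tabulate-unique (isOut? s a) (λ b → s , b , t) a (refl , refl) (λ b p → proj₂ p)

∈-fan⁺ : ∀ {n k} {s t : Fin n} (a : Fin k) → (s , a , t) ∈ fan s t
∈-fan⁺ {s = s} {t} = ∈-tabulate⁺ {f = λ b → s , b , t}

∈-fan⁻ : ∀ {n k} {s s' t t' : Fin n} {a : Fin k} → (s , a , t) ∈ fan s' t' → s ≡ s' × t ≡ t'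
∈-fan⁻ {s' = s'} {t' = t'} e∈ with ∈-tabulate⁻ {f = λ b → s' , b , t'} e∈
... | _ , refl = refl , refl

perm-adjoint : ∀ {k} (π : Permutation′ k) {a b : Fin k} → π ⟨$⟩ˡ a ≡ b ⇔ a ≡ π ⟨$⟩ʳ b
perm-adjoint π = mk⇔ (λ eq → trans (sym (inverseʳ π)) (cong (π ⟨$⟩ʳ_) eq))
                     (λ eq → trans (cong (π ⟨$⟩ˡ_) eq) (inverseˡ π))

_⊙_ : ∀ {V : Set} {k} → (V → Permutation′ k) → (V → Fin k) → V → Fin k
(π ⊙ x) j = π j ⟨$⟩ʳ x j

query≢final : ∀ {V R : Set} {j : V} {r : R} → ¬ (Label.query j ≡ final r)
query≢final ()

_◅◅_ : ∀ {V R k n} {P : BP V R k n} {x s t u} → Reach P x s t → Reach P x t u → Reach P x s u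
here                  ◅◅ q = q
step j e∈ lab xj≡ p ◅◅ q = step j e∈ lab xj≡ (p ◅◅ q)

module _ {V R : Set} {k n : ℕ} (P : BP V R k n) where

  source-query : ∀ {s a t} → (s , a , t) ∈ edges P → Σ V (λ j → label P s ≡ query j)
  source-query {s} e∈ with label P s | sink P e∈
  ... | query j | _ = j , refl
  ... | final r | notFinal = ⊥-elim (notFinal r refl)

  no-out-of-final : ∀ {s r} (a : Fin k) → label P s ≡ final r → count (isOut? s a) (edges P) ≡ 0
  no-out-of-final {r = r} a lab = count-none (isOut? _ a) (edges P) λ { e∈ (refl , _) → sink P e∈ r lab }

  stays-final : ∀ {x s t r} → label P s ≡ final r → Reach P x s t → t ≡ s
  stays-final lab here = refl
  stays-final lab (step j e∈ lab' _ _) with trans (sym lab) lab'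
  ... | ()

  output-path : ∀ {g} → Computes P g → ∀ x →
    Σ (Fin n) (λ t → Reach P x (root P) t × label P t ≡ final (g x))
  output-path comp x with proj₂ (comp x)
  ... | t , r , path , lab = t , path , subst (λ r → label P t ≡ final r) (proj₁ (comp x) t r path lab) lab

-- From a functional program to a decision program with the same states.

module Decide {V : Set} (v₀ : V) {k' n : ℕ} (P : BP V (Fin (suc (suc k'))) (suc (suc k')) n) where

  private
    k : ℕ
    k = suc (suc k')

  fromBool : Bool → Fin k
  fromBool true  = zero
  fromBool false = suc zero

  boolLabel : Label V (Fin k) → Label V Bool
  boolLabel (query j)              = query j
  boolLabel (final zero)           = final true
  boolLabel (final (suc zero))     = final false
  boolLabel (final (suc (suc _)))  = query v₀

  boolLabel-final : ∀ {l b} → boolLabel l ≡ final b → l ≡ final (fromBool b)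
  boolLabel-final {final zero}       refl = refl
  boolLabel-final {final (suc zero)} refl = refl

  boolLabel-query : ∀ {l j j'} → l ≡ query j' → boolLabel l ≡ query j → l ≡ query j
  boolLabel-query refl refl = refl

  reject : Fin n
  reject = proj₁ (finalE P (suc zero))

  redirect : Fin n → Label V (Fin k) → List (Edge n k)
  redirect s (final (suc (suc _))) = fan s reject
  redirect s _                     = []

  redirect-view : ∀ {s' s a t} l → (s , a , t) ∈ redirect s' l →
    s ≡ s' × Σ (Fin k') (λ r → l ≡ final (suc (suc r))) × t ≡ reject
  redirect-view (final (suc (suc r))) e∈ with ∈-fan⁻ e∈
  ... | refl , refl = refl , (r , refl) , refl

  redirections : List (Edge n k)
  redirections = concat (tabulate (λ s → redirect s (label P s)))

  redirections-view : ∀ {s a t} → (s , a , t) ∈ redirections →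
    Σ (Fin k') (λ r → label P s ≡ final (suc (suc r))) × t ≡ reject
  redirections-view e∈ with ∈-blocks⁻ (λ s → redirect s (label P s)) e∈
  ... | s' , e∈s' with redirect-view (label P s') e∈s'
  ... | refl , lab , t≡ = lab , t≡

  redirection-∈ : ∀ {s r} a → label P s ≡ final (suc (suc r)) → (s , a , reject) ∈ redirections
  redirection-∈ {s} a lab = ∈-blocks⁺ (λ s → redirect s (label P s)) s
    (subst (λ l → (s , a , reject) ∈ redirect s l) (sym lab) (∈-fan⁺ a))

  decider : BP V Bool k n
  root decider = root P
  label decider s = boolLabel (label P s)
  edges decider = edges P ++ redirections
  sink decider e∈ r lab with ∈-++⁻ (edges P) e∈
  ... | inj₁ e∈P with source-query P e∈P
  ...   | j , lab' with trans (sym (cong boolLabel lab')) lab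
  ...     | ()
  sink decider e∈ r lab | inj₂ e∈R with redirections-view e∈R
  ... | (r' , lab') , _ with trans (sym (cong boolLabel lab')) lab
  ...   | ()
  finalE decider true  = proj₁ (finalE P zero) , cong boolLabel (proj₂ (finalE P zero))
  finalE decider false = reject , cong boolLabel (proj₂ (finalE P (suc zero)))
  finalU decider b s s' lab lab' = finalU P (fromBool b) s s' (boolLabel-final lab) (boolLabel-final lab')

  lift : ∀ {x s t} → Reach P x s t → Reach decider x s t
  lift here = here
  lift (step j e∈ lab xj≡ p) = step j (∈-++⁺ˡ e∈) (cong boolLabel lab) xj≡ (lift p)

  unlift : ∀ {x s t b} → Reach decider x s t → label decider t ≡ final b →
    Σ (Fin n) (λ u → Σ (Fin k) (λ r → Reach P x s u × label P u ≡ final r × b ≡ isOne r))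
  unlift {b = true}  here lab = _ , zero , here , boolLabel-final lab , refl
  unlift {b = false} here lab = _ , suc zero , here , boolLabel-final lab , refl
  unlift (step j e∈ lab xj≡ p) labₜ with ∈-++⁻ (edges P) e∈
  ... | inj₁ e∈P with unlift p labₜ
  ...   | u , r , q , labᵤ , b≡ =
          u , r , step j e∈P (boolLabel-query (proj₂ (source-query P e∈P)) lab) xj≡ q , labᵤ , b≡
  unlift (step j e∈ lab xj≡ p) labₜ | inj₂ e∈R with redirections-view e∈R
  ... | (r , labₛ) , refl with stays-final decider (proj₂ (finalE decider false)) p
  ...   | refl with trans (sym (proj₂ (finalE decider false))) labₜ
  ...     | refl = _ , suc (suc r) , here , labₛ , refl

  computes : ∀ {g} → Computes P g → Computes decider (λ x → isOne (g x))
  proj₁ (computes comp x) t b path lab with unlift path lab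
  ... | u , r , q , labᵤ , b≡ = trans b≡ (cong isOne (proj₁ (comp x) u r q labᵤ))
  proj₂ (computes {g} comp x) with output-path P comp x
  ... | t , path , lab = finish (g x) lab
    where
    finish : ∀ r → label P t ≡ final r →
      Σ (Fin n) (λ u → Σ Bool (λ b → Reach decider x (root P) u × label decider u ≡ final b))
    finish zero          labₜ = t , true  , lift path , cong boolLabel labₜ
    finish (suc zero)    labₜ = t , false , lift path , cong boolLabel labₜ
    finish (suc (suc r)) labₜ =
      reject , false ,
      lift path ◅◅ step v₀ (∈-++⁺ʳ (edges P) (redirection-∈ (x v₀) labₜ)) (cong boolLabel labₜ) refl here ,
      proj₂ (finalE decider false)

  redirections-out : ∀ s a → count (isOut? s a) redirections ≡ count (isOut? s a) (redirect s (label P s))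
  redirections-out s a = count-block (isOut? s a) (λ s' → redirect s' (label P s')) s only-s
    where
    only-s : ∀ s' {e} → e ∈ redirect s' (label P s') → IsOut s a e → s' ≡ s
    only-s s' {_ , _ , _} e∈ (refl , _) = sym (proj₁ (redirect-view (label P s') e∈))

  deterministic : Deterministic P → Deterministic decider
  deterministic det s j lab a = begin
    count (isOut? s a) (edges P ++ redirections)
      ≡⟨ count-++ (isOut? s a) (edges P) redirections ⟩
    count (isOut? s a) (edges P) + count (isOut? s a) redirections
      ≡⟨ cong (count (isOut? s a) (edges P) +_) (redirections-out s a) ⟩
    count (isOut? s a) (edges P) + count (isOut? s a) (redirect s (label P s))
      ≡⟨ by-label (label P s) refl lab ⟩
    1 ∎
    where
    open ≡-Reasoning
    by-label : ∀ l → label P s ≡ l → boolLabel l ≡ query j →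
      count (isOut? s a) (edges P) + count (isOut? s a) (redirect s l) ≡ 1
    by-label (query j')            labₛ _ = trans (+-identityʳ _) (det s j' labₛ a)
    by-label (final zero)          _    ()
    by-label (final (suc zero))    _    ()
    by-label (final (suc (suc r))) labₛ _ = cong₂ _+_ (no-out-of-final P a labₛ) (out-fan s reject a)

-- From a decision program to a functional program with k copies of it.
-- Copy i runs the program on σ i ⊙ x, which it accepts iff g x = i.

module Search {V : Set} (v₀ : V) {k' n : ℕ}
  (g : (V → Fin (suc k')) → Fin (suc k')) (h : (V → Fin (suc k')) → Bool)
  (σ : Fin (suc k') → V → Permutation′ (suc k'))
  (test : ∀ i x → (h (σ i ⊙ x) ≡ true) ⇔ (g x ≡ i))
  (P : BP V Bool (suc k') n) where

  private
    k : ℕ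
    k = suc k'

  open Equivalence using (to; from)

  accept reject : Fin n
  accept = proj₁ (finalE P true)
  reject = proj₁ (finalE P false)

  copy : Fin k → Fin n → Fin (k * n)
  copy = combine

  copyLabel : Fin k → Label V Bool → Label V (Fin k)
  copyLabel i (query j)     = query j
  copyLabel i (final true)  = final i
  copyLabel i (final false) = query v₀

  copyLabel-final : ∀ {i l r} → copyLabel i l ≡ final r → l ≡ final true × r ≡ i
  copyLabel-final {l = final true} refl = refl , refl

  copyLabel-query : ∀ {i l j j'} → l ≡ query j' → copyLabel i l ≡ query j → l ≡ query j
  copyLabel-query refl refl = refl

  stateLabel : Fin (k * n) → Label V (Fin k)
  stateLabel t = copyLabel (proj₁ (remQuot {k} n t)) (label P (proj₂ (remQuot {k} n t)))

  label-copy : ∀ i {s l} → label P s ≡ l → stateLabel (copy i s) ≡ copyLabel i l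
  label-copy i {s} refl = cong (λ p → copyLabel (proj₁ p) (label P (proj₂ p))) (remQuot-combine i s)

  -- the value x j under which copy i takes a P-edge labelled a
  edgeLabel : Fin k → Label V Bool → Fin k → Fin k
  edgeLabel i (query j) a = σ i j ⟨$⟩ˡ a
  edgeLabel i (final _) a = a

  pushLabel : Fin k → Label V Bool → Fin k → Fin k
  pushLabel i (query j) b = σ i j ⟨$⟩ʳ b
  pushLabel i (final _) b = b

  edgeLabel-adjoint : ∀ i l {a b} → edgeLabel i l a ≡ b ⇔ a ≡ pushLabel i l b
  edgeLabel-adjoint i (query j) = perm-adjoint (σ i j)
  edgeLabel-adjoint i (final _) = ⇔-id _

  liftEdge : Fin k → Edge n k → Edge (k * n) k
  liftEdge i (s , a , t) = copy i s , edgeLabel i (label P s) a , copy i t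

  -- i + 1, or i itself for the last copy (which never rejects)
  next : Fin k → Fin k
  next i with suc (toℕ i) <? k
  ... | yes i+1<k = fromℕ< i+1<k
  ... | no _      = i

  next-suc : ∀ {i j : Fin k} → i Fin.< j → toℕ (next i) ≡ suc (toℕ i)
  next-suc {i} {j} i<j with suc (toℕ i) <? k
  ... | yes i+1<k = toℕ-fromℕ< i+1<k
  ... | no i+1≮k  = ⊥-elim (i+1≮k (≤-trans (s≤s i<j) (toℕ<n j)))

  next-≤ : ∀ {i j : Fin k} → i Fin.< j → next i Fin.≤ j
  next-≤ {j = j} i<j = subst (_≤ toℕ j) (sym (next-suc i<j)) i<j

  passEdges : Fin k → List (Edge (k * n) k)
  passEdges i = fan (copy i reject) (copy (next i) (root P))

  block : Fin k → List (Edge (k * n) k)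
  block i = map (liftEdge i) (edges P) ++ passEdges i

  block-view : ∀ {i e} → e ∈ block i →
    Σ (Edge n k) (λ e₀ → e₀ ∈ edges P × e ≡ liftEdge i e₀) ⊎ e ∈ passEdges i
  block-view {i} e∈ with ∈-++⁻ (map (liftEdge i) (edges P)) e∈
  ... | inj₁ e∈L = inj₁ (∈-map⁻ (liftEdge i) e∈L)
  ... | inj₂ e∈F = inj₂ e∈F

  block-source : ∀ {i e} → e ∈ block i → Σ (Fin n) (λ s → proj₁ e ≡ copy i s)
  block-source e∈ with block-view e∈
  ... | inj₁ ((s , _ , _) , _ , refl) = s , refl
  ... | inj₂ e∈F = reject , proj₁ (∈-fan⁻ e∈F)

  searcher : BP V (Fin k) k (k * n)
  root searcher = copy zero (root P)
  label searcher = stateLabel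
  edges searcher = concat (tabulate block)
  sink searcher e∈ r lab with ∈-blocks⁻ block e∈
  ... | i , e∈i with block-view e∈i
  ...   | inj₁ ((s , _ , _) , e∈P , refl) with trans (sym (label-copy i (proj₂ (source-query P e∈P)))) lab
  ...     | ()
  sink searcher e∈ r lab | i , e∈i | inj₂ e∈F with ∈-fan⁻ e∈F
  ...   | refl , _ with trans (sym (label-copy i (proj₂ (finalE P false)))) lab
  ...     | ()
  finalE searcher r = copy r accept , label-copy r (proj₂ (finalE P true))
  finalU searcher r t t' lab lab' = trans (final-state t lab) (sym (final-state t' lab'))
    where
    final-state : ∀ t → stateLabel t ≡ final r → t ≡ copy r accept
    final-state t lab with combine-surjective {k} {n} t
    ... | i , s , refl with copyLabel-final {i} (trans (sym (label-copy i {s} refl)) lab)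
    ...   | labₛ , refl = cong (copy r) (finalU P true s accept labₛ (proj₂ (finalE P true)))

  edge-view : ∀ {i s b u} → (copy i s , b , u) ∈ edges searcher →
    Σ (Fin k) (λ a → Σ (Fin n) (λ t → (s , a , t) ∈ edges P × b ≡ edgeLabel i (label P s) a × u ≡ copy i t))
    ⊎ (s ≡ reject × u ≡ copy (next i) (root P))
  edge-view {i} {s} e∈ with ∈-blocks⁻ block e∈
  ... | i' , e∈i' with block-view e∈i'
  ...   | inj₁ ((s₀ , a₀ , t₀) , e∈P , eq) with combine-injective i s i' s₀ (cong proj₁ eq)
  ...     | refl , refl with eq
  ...       | refl = inj₁ (a₀ , t₀ , e∈P , refl , refl)
  edge-view {i} {s} e∈ | i' , e∈i' | inj₂ e∈F with ∈-fan⁻ e∈F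
  ...     | s≡ , refl with combine-injective i s i' reject s≡
  ...       | refl , refl = inj₂ (refl , refl)

  liftPath : ∀ {x} i {s t} → Reach P (σ i ⊙ x) s t → Reach searcher x (copy i s) (copy i t)
  liftPath i here = here
  liftPath {x} i (step {s} {a} j e∈ lab xj≡ p) =
    step j (∈-blocks⁺ block i (∈-++⁺ˡ (∈-map⁺ (liftEdge i) e∈))) (label-copy i lab) value (liftPath i p)
    where
    value : x j ≡ edgeLabel i (label P s) a
    value rewrite lab = sym (from (perm-adjoint (σ i j)) (sym xj≡))

  pass : ∀ {x} i → Reach searcher x (copy i reject) (copy (next i) (root P))
  pass {x} i = step v₀ (∈-blocks⁺ block i (∈-++⁺ʳ (map (liftEdge i) (edges P)) (∈-fan⁺ (x v₀))))
                 (label-copy i (proj₂ (finalE P false))) refl here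

  module _ (comp : Computes P h) where

    rejected : ∀ {x i} → Reach P (σ i ⊙ x) (root P) reject → g x ≢ i
    rejected {x} {i} p gx≡i
      with trans (proj₁ (comp (σ i ⊙ x)) reject false p (proj₂ (finalE P false))) (from (test i x) gx≡i)
    ... | ()

    advance : ∀ {x i} → i Fin.< g x → Reach searcher x (copy i (root P)) (copy (next i) (root P))
    advance {x} {i} i<gx with output-path P comp (σ i ⊙ x)
    ... | t , p , labₜ with finalU P false t reject (trans labₜ (cong final h≡false)) (proj₂ (finalE P false))
      where
      h≡false : h (σ i ⊙ x) ≡ false
      h≡false = ¬-not (λ h≡true → <⇒≢ i<gx (sym (to (test i x) h≡true)))
    ...   | refl = liftPath i p ◅◅ pass i

    reach-copy : ∀ {x} m i → toℕ i + m ≡ toℕ (g x) → Reach searcher x (copy i (root P)) (copy (g x) (root P))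
    reach-copy zero i i+0≡ with toℕ-injective (trans (sym (+-identityʳ (toℕ i))) i+0≡)
    ... | refl = here
    reach-copy {x} (suc m) i i+m+1≡ =
      advance i<gx ◅◅ reach-copy m (next i) (trans (cong (_+ m) (next-suc i<gx)) (trans (sym (+-suc (toℕ i) m)) i+m+1≡))
      where
      i<gx : i Fin.< g x
      i<gx = subst (toℕ i ℕ.<_) i+m+1≡ (m<m+n (toℕ i) (s≤s z≤n))

    sound : ∀ {x i s t r} → i Fin.≤ g x → Reach P (σ i ⊙ x) (root P) s →
      Reach searcher x (copy i s) t → stateLabel t ≡ final r → r ≡ g x
    sound {x} {i} {s} i≤gx p here lab with copyLabel-final {i} (trans (sym (label-copy i {s} refl)) lab)
    ... | labₛ , refl = sym (to (test i x) (sym (proj₁ (comp (σ i ⊙ x)) s true p labₛ)))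
    sound {x} {i} {s} i≤gx p (step j e∈ lab xj≡ q) labₜ with edge-view {i} {s} e∈
    ... | inj₁ (a , t , e∈P , refl , refl) = sound i≤gx (p ◅◅ step j e∈P labₛ value here) q labₜ
      where
      labₛ : label P s ≡ query j
      labₛ = copyLabel-query (proj₂ (source-query P e∈P)) (trans (sym (label-copy i refl)) lab)
      value : (σ i ⊙ x) j ≡ a
      value rewrite labₛ = sym (to (perm-adjoint (σ i j)) (sym xj≡))
    ... | inj₂ (refl , refl) = sound (next-≤ i<gx) here q labₜ
      where
      i<gx : i Fin.< g x
      i<gx = ≤∧≢⇒< i≤gx (λ i≡gx → rejected p (sym i≡gx))

    computes : Computes searcher g
    proj₁ (computes x) t r path lab = sound z≤n here path lab
    proj₂ (computes x) with output-path P comp (σ (g x) ⊙ x)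
    ... | t , p , labₜ =
      copy (g x) t , g x ,
      reach-copy (toℕ (g x)) zero refl ◅◅ liftPath (g x) p ,
      label-copy (g x) (trans labₜ (cong final (from (test (g x) x) refl)))

  lifted-out : ∀ i s a → count (isOut? (copy i s) a) (map (liftEdge i) (edges P))
                       ≡ count (isOut? s (pushLabel i (label P s) a)) (edges P)
  lifted-out i s a = count-map (isOut? (copy i s) a) (isOut? s _) (liftEdge i) (edges P) agree
    where
    agree : ∀ {e} → e ∈ edges P → IsOut (copy i s) a (liftEdge i e) ⇔ IsOut s (pushLabel i (label P s) a) e
    agree {s₀ , a₀ , t₀} _ = mk⇔ forth back
      where
      forth : IsOut (copy i s) a (liftEdge i (s₀ , a₀ , t₀)) → IsOut s (pushLabel i (label P s) a) (s₀ , a₀ , t₀)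
      forth (copy≡ , a≡) with combine-injective i s₀ i s copy≡
      ... | _ , refl = refl , to (edgeLabel-adjoint i (label P s)) a≡
      back : IsOut s (pushLabel i (label P s) a) (s₀ , a₀ , t₀) → IsOut (copy i s) a (liftEdge i (s₀ , a₀ , t₀))
      back (refl , a≡) = refl , from (edgeLabel-adjoint i (label P s)) a≡

  pass-out : ∀ i s a → s ≢ reject → count (isOut? (copy i s) a) (passEdges i) ≡ 0
  pass-out i s a s≢reject = count-none (isOut? (copy i s) a) (passEdges i) no-pass
    where
    no-pass : ∀ {e} → e ∈ passEdges i → ¬ IsOut (copy i s) a e
    no-pass {_ , _ , _} e∈ (refl , _) = s≢reject (sym (proj₂ (combine-injective i reject i s (sym (proj₁ (∈-fan⁻ e∈))))))

  deterministic : Deterministic P → Deterministic searcher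
  deterministic det t j lab a with combine-surjective {k} {n} t
  ... | i , s , refl = begin
    count O (concat (tabulate block))
      ≡⟨ count-block O block i only-i ⟩
    count O (map (liftEdge i) (edges P) ++ passEdges i)
      ≡⟨ count-++ O (map (liftEdge i) (edges P)) (passEdges i) ⟩
    count O (map (liftEdge i) (edges P)) + count O (passEdges i)
      ≡⟨ cong (_+ count O (passEdges i)) (lifted-out i s a) ⟩
    count (isOut? s (pushLabel i (label P s) a)) (edges P) + count O (passEdges i)
      ≡⟨ by-label (label P s) refl (trans (sym (label-copy i refl)) lab) ⟩
    1 ∎
    where
    open ≡-Reasoning
    O : Decidable (IsOut (copy i s) a)
    O = isOut? (copy i s) a
    only-i : ∀ i' {e} → e ∈ block i' → IsOut (copy i s) a e → i' ≡ i
    only-i i' e∈ (src≡ , _) with block-source e∈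
    ... | s₀ , src≡′ = proj₁ (combine-injective i' s₀ i s (trans (sym src≡′) src≡))
    by-label : ∀ l → label P s ≡ l → copyLabel i l ≡ query j →
      count (isOut? s (pushLabel i l a)) (edges P) + count O (passEdges i) ≡ 1
    by-label (query j') labₛ _ =
      cong₂ _+_ (det s j' labₛ _)
                (pass-out i s a λ { refl → query≢final (trans (sym labₛ) (proj₂ (finalE P false))) })
    by-label (final true) _ ()
    by-label (final false) labₛ _ with finalU P false s reject labₛ (proj₂ (finalE P false))
    ... | refl = cong₂ _+_ (no-out-of-final P a labₛ) (out-fan (copy i reject) _ a)

-- The tree evaluation problem.

swapRoot : ∀ {d k' e} → Fin (suc k') → TV d (suc k') (suc e) → Permutation′ (suc k')
swapRoot i (inj₁ _) = transpose i zero
swapRoot i (inj₂ _) = id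

transpose-to-zero : ∀ {k} (i y : Fin (suc k)) → (transpose i zero ⟨$⟩ʳ y ≡ zero) ⇔ (y ≡ i)
transpose-to-zero i y = mk⇔
  (λ eq → trans (sym (Components.transpose-inverse zero i)) (cong (Components.transpose zero i) eq))
  (λ { refl → Components.transpose-inverse i zero })

isOne-true : ∀ {k} (y : Fin (suc k)) → (isOne y ≡ true) ⇔ (y ≡ zero)
isOne-true zero    = mk⇔ (λ _ → refl) (λ _ → refl)
isOne-true (suc y) = mk⇔ (λ ()) (λ ())

swapRoot-test : ∀ {d k' e} i (x : TV d (suc k') (suc e) → Fin (suc k')) →
  (isOne (evalT d (suc k') (suc e) (swapRoot i ⊙ x)) ≡ true) ⇔ (evalT d (suc k') (suc e) x ≡ i)
swapRoot-test {d} {k'} {e} i x =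
  transpose-to-zero i (evalT d (suc k') (suc e) x) ⇔-∘ isOne-true (evalT d (suc k') (suc e) (swapRoot i ⊙ x))

minima-bounds : ∀ {Q₁ Q₂ : ℕ → Set} (c : ℕ) →
  (∀ {n} → Q₂ n → Q₁ n) → (∀ {n} → Q₁ n → Q₂ (c * n)) →
  ∀ {m₁ m₂} → IsMin Q₁ m₁ → IsMin Q₂ m₂ → m₁ ≤ m₂ × m₂ ≤ c * m₁
minima-bounds c down up (q₁ , min₁) (q₂ , min₂) = min₁ _ (down q₂) , min₂ _ (up q₁)

lemma2p3 : ∀ (d h k : ℕ) → 2 ≤ d → 2 ≤ h → 2 ≤ k →
    (∀ dB dF → IsDetB d h k dB → IsDetF d h k dF → dB ≤ dF × dF ≤ k * dB) ×
    (∀ nB nF → IsNdetB d h k nB → IsNdetF d h k nF → nB ≤ nF × nF ≤ k * nB)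
lemma2p3 d h@(suc (suc _)) k@(suc (suc _)) _ (s≤s (s≤s _)) (s≤s (s≤s _)) =
  (λ _ _ → minima-bounds k
     (λ { (P , det , comp) → D.decider P , D.deterministic P det , D.computes P comp })
     (λ { (P , det , comp) → S.searcher P , S.deterministic P det , S.computes P comp })) ,
  (λ _ _ → minima-bounds k
     (λ { (P , comp) → D.decider P , D.computes P comp })
     (λ { (P , comp) → S.searcher P , S.computes P comp }))
  where
  -- any variable will do for the query states added by the transformations
  v₀ : TreeVar d h k
  v₀ = inj₁ (replicate d zero)
  module D {n : ℕ} = Decide v₀ {n = n}
  module S {n : ℕ} = Search v₀ {n = n} (FT d h k) (BT d h k) swapRoot swapRoot-test
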